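{- Let $b \ge 2$ be an integer, let $x_n$ be the base $b$ van der Corput sequence, and let $S(N) = \sum_{n=0}^{N-1} \left( \frac{1}{2} - x_n \right)$. Let $N = \sum_{i=1}^{m} a_i b^{i-1}$ be the base $b$ representation of an integer $N \ge 0$, where $a_i \in \{0,1,\dots,b-1\}$. Then \[ S(N) = \sum_{i=1}^m \frac{(b+1) a_i - a_i^2}{2b} - \sum_{1 \le i < j \le m} \frac{a_i a_j}{b^{j-i+1}} . \]
   Context: For an integer $b \ge 2$, the base $b$ van der Corput sequence $(x_n)_{n\ge 0}$ is defined as follows: if $n = \sum_{i=1}^m a_i b^{i-1}$ with digits $a_i \in \{0,1,\dots,b-1\}$, then $x_n = \sum_{i=1}^m a_i b^{ -i}$. -}

module Defs where

open import Data.Nat as ℕ using (ℕ; zero; suc; NonZero)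
open import Data.Nat.DivMod using (_%_; _div_)
open import Data.Integer using (+_)
open import Data.Rational using (ℚ; 0ℚ; _+_; _-_; _*_; _/_; ½)

sumFrom1 : ℕ → (ℕ → ℚ) → ℚ
sumFrom1 zero    f = 0ℚ
sumFrom1 (suc m) f = sumFrom1 m f + f (suc m)

sumBelow : ℕ → (ℕ → ℚ) → ℚ
sumBelow zero    f = 0ℚ
sumBelow (suc N) f = sumBelow N f + f N

_//_ : ℕ → (d : ℕ) → .{{_ : NonZero d}} → ℚ
k // d = (+ k) / d

-- Radical inverse with fuel: if n = Σ a_i b^{i-1} then value = Σ a_i b^{-i}.
-- Computed as x(n) = (n mod b + x(n div b)) / b, x(0) = 0. Fuel n suffices since n div b < n.
vdcAux : (b : ℕ) .{{_ : NonZero b}} → ℕ → ℕ → ℚ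
vdcAux b zero    n = 0ℚ
vdcAux b (suc k) zero = 0ℚ
vdcAux b (suc k) (suc n) =
  ((suc n % b) // 1 + vdcAux b k (suc n div b)) * (1 // b)

vdc : (b : ℕ) .{{_ : NonZero b}} → ℕ → ℚ
vdc b n = vdcAux b n n

S : (b : ℕ) .{{_ : NonZero b}} → ℕ → ℚ
S b N = sumBelow N (λ n → ½ - vdc b n)

digitValue : ℕ → (m : ℕ) → (ℕ → ℕ) → ℕ
digitValue b zero    a = 0
digitValue b (suc m) a = digitValue b m a ℕ.+ a (suc m) ℕ.* b ℕ.^ m

module Submission where

-- Digit formula for the partial sums S(N) = Σ_{n<N} (½ - x n) of the base-b
-- van der Corput sequence x.  Write R = 1/b.
--
-- A leading digit c < b in position m+1 shifts the sequence by a constant: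
-- x(c·bᵐ + r) = x(r) + c·Rᵐ⁺¹ for r < bᵐ (vdc-block).  Summing over r < N' ≤ bᵐ,
--     S(c·bᵐ + N') = S(c·bᵐ) + S(N') - N'·c·Rᵐ⁺¹                    (S-shift),
-- and taking N' = bᵐ, induction on m and c gives the block sums
--     S(bᵐ) = ½,   S(c·bᵐ) = c/2 - c(c-1)/(2b) = digitTerm c         (S-pow, S-block).
-- So the leading digit of N = N' + a_{m+1}·bᵐ contributes digitTerm a_{m+1}, the
-- diagonal term ((b+1)a - a²)/(2b) (digitTerm-formula), and -N'·a_{m+1}·Rᵐ⁺¹, the
-- new column of the double sum (column-sum); induction on m proves the theorem.

open import Defs
open import Data.Nat as ℕ using (ℕ; zero; suc; NonZero; _≤_; _<_; z≤n; s≤s; _∸_)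
open import Data.Nat.Properties using (m^n≢0; m*n≢0)
import Data.Nat.Properties as ℕP
open import Data.Nat.DivMod
  using (_%_; _/_; m≡m%n+[m/n]*n; m%n<n; [m+kn]%n≡m%n; m<n⇒m%n≡m; 0/n≡0;
         +-distrib-/-∣ʳ; m<n⇒m/n≡0; m*n/n≡m; m/n<m; m<n*o⇒m/o<n)
open import Data.Nat.Divisibility using (n∣m*n)
open import Data.Nat.Tactic.RingSolver using (solve-∀)
import Data.Integer as ℤ
import Data.Integer.Properties as ℤP
open import Data.Rational using (ℚ; 0ℚ; 1ℚ; _+_; _-_; _*_; ½; fromℚᵘ; toℚᵘ)
open import Data.Rational.Properties
  using (toℚᵘ-injective; toℚᵘ-fromℚᵘ; toℚᵘ-homo-+; toℚᵘ-homo-*; fromℚᵘ-cong;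
         *-comm; *-zeroˡ; *-identityʳ; +-*-commutativeRing)
import Data.Rational.Unnormalised as ℚᵘ
import Data.Rational.Unnormalised.Properties as ℚᵘP
open import Data.Rational.Solver using (module +-*-Solver)
open import Algebra.Bundles using (CommutativeRing)
open import Algebra.Properties.Semiring.Exp (CommutativeRing.semiring +-*-commutativeRing)
  using (_^_; ^-homo-*)
open import Relation.Binary.PropositionalEquality

-- fromℚᵘ preserves + and *, since toℚᵘ does and is a section of fromℚᵘ.
module FromUnnormalised where
  open ℚᵘP.≃-Reasoning

  fromℚᵘ-+ : ∀ p q → fromℚᵘ (p ℚᵘ.+ q) ≡ fromℚᵘ p + fromℚᵘ q
  fromℚᵘ-+ p q = toℚᵘ-injective (begin
    toℚᵘ (fromℚᵘ (p ℚᵘ.+ q))              ≈⟨ toℚᵘ-fromℚᵘ (p ℚᵘ.+ q) ⟩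
    p ℚᵘ.+ q                              ≈⟨ ℚᵘP.+-cong (ℚᵘP.≃-sym (toℚᵘ-fromℚᵘ p)) (ℚᵘP.≃-sym (toℚᵘ-fromℚᵘ q)) ⟩
    toℚᵘ (fromℚᵘ p) ℚᵘ.+ toℚᵘ (fromℚᵘ q)  ≈⟨ ℚᵘP.≃-sym (toℚᵘ-homo-+ (fromℚᵘ p) (fromℚᵘ q)) ⟩
    toℚᵘ (fromℚᵘ p + fromℚᵘ q)            ∎)

  fromℚᵘ-* : ∀ p q → fromℚᵘ (p ℚᵘ.* q) ≡ fromℚᵘ p * fromℚᵘ q
  fromℚᵘ-* p q = toℚᵘ-injective (begin
    toℚᵘ (fromℚᵘ (p ℚᵘ.* q))              ≈⟨ toℚᵘ-fromℚᵘ (p ℚᵘ.* q) ⟩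
    p ℚᵘ.* q                              ≈⟨ ℚᵘP.*-cong (ℚᵘP.≃-sym (toℚᵘ-fromℚᵘ p)) (ℚᵘP.≃-sym (toℚᵘ-fromℚᵘ q)) ⟩
    toℚᵘ (fromℚᵘ p) ℚᵘ.* toℚᵘ (fromℚᵘ q)  ≈⟨ ℚᵘP.≃-sym (toℚᵘ-homo-* (fromℚᵘ p) (fromℚᵘ q)) ⟩
    toℚᵘ (fromℚᵘ p * fromℚᵘ q)            ∎)

open FromUnnormalised using (fromℚᵘ-+; fromℚᵘ-*)
open ≡-Reasoning
open +-*-Solver

-- The embedding of ℕ into ℚ.  For d = suc d', k // d is fromℚᵘ (mkℚᵘ (ℤ.+ k) d'),
-- so each identity between fractions below reduces to one between integers.
ι : ℕ → ℚ
ι n = n // 1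

ι-+ : ∀ m n → ι (m ℕ.+ n) ≡ ι m + ι n
ι-+ m n = trans (fromℚᵘ-cong {ℚᵘ.mkℚᵘ (ℤ.+ (m ℕ.+ n)) 0} {p ℚᵘ.+ q} (ℚᵘ.*≡* numerators)) (fromℚᵘ-+ p q)
  where
  p = ℚᵘ.mkℚᵘ (ℤ.+ m) 0
  q = ℚᵘ.mkℚᵘ (ℤ.+ n) 0
  numerators : ℤ.+ (m ℕ.+ n) ℤ.* ℤ.+ 1 ≡ (ℤ.+ m ℤ.* ℤ.+ 1 ℤ.+ ℤ.+ n ℤ.* ℤ.+ 1) ℤ.* ℤ.+ 1
  numerators = cong (ℤ._* ℤ.+ 1) (trans (ℤP.pos-+ m n)
    (cong₂ ℤ._+_ (sym (ℤP.*-identityʳ (ℤ.+ m))) (sym (ℤP.*-identityʳ (ℤ.+ n)))))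

ι-* : ∀ m n → ι (m ℕ.* n) ≡ ι m * ι n
ι-* m n = trans (fromℚᵘ-cong {ℚᵘ.mkℚᵘ (ℤ.+ (m ℕ.* n)) 0} {p ℚᵘ.* q} (ℚᵘ.*≡* (cong (ℤ._* ℤ.+ 1) (ℤP.pos-* m n))))
                (fromℚᵘ-* p q)
  where
  p = ℚᵘ.mkℚᵘ (ℤ.+ m) 0
  q = ℚᵘ.mkℚᵘ (ℤ.+ n) 0

ι-∸ : ∀ m n → n ≤ m → ι (m ∸ n) ≡ ι m - ι n
ι-∸ m n n≤m = begin
  ι (m ∸ n)                  ≡⟨ solve 2 (λ x y → x := (x :+ y) :- y) refl (ι (m ∸ n)) (ι n) ⟩
  (ι (m ∸ n) + ι n) - ι n    ≡⟨ cong (_- ι n) (sym (ι-+ (m ∸ n) n)) ⟩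
  ι (m ∸ n ℕ.+ n) - ι n      ≡⟨ cong (λ k → ι k - ι n) (ℕP.m∸n+n≡m n≤m) ⟩
  ι m - ι n                  ∎

//-as-product : ∀ k d .{{_ : NonZero d}} → k // d ≡ ι k * (1 // d)
//-as-product k (suc d) =
  trans (fromℚᵘ-cong {ℚᵘ.mkℚᵘ (ℤ.+ k) d} {p ℚᵘ.* q} (ℚᵘ.*≡* numerators)) (fromℚᵘ-* p q)
  where
  p = ℚᵘ.mkℚᵘ (ℤ.+ k) 0
  q = ℚᵘ.mkℚᵘ (ℤ.+ 1) d
  numerators : ℤ.+ k ℤ.* ℤ.+ (1 ℕ.* suc d) ≡ (ℤ.+ k ℤ.* ℤ.+ 1) ℤ.* ℤ.+ suc d
  numerators = trans (cong (λ e → ℤ.+ k ℤ.* ℤ.+ e) (ℕP.*-identityˡ (suc d)))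
                     (cong (ℤ._* ℤ.+ suc d) (sym (ℤP.*-identityʳ (ℤ.+ k))))

1//-* : ∀ d e .{{_ : NonZero d}} .{{_ : NonZero e}} →
        _//_ 1 (d ℕ.* e) {{m*n≢0 d e}} ≡ (1 // d) * (1 // e)
1//-* (suc d) (suc e) = fromℚᵘ-* (ℚᵘ.mkℚᵘ (ℤ.+ 1) d) (ℚᵘ.mkℚᵘ (ℤ.+ 1) e)

1//-inverse : ∀ d .{{_ : NonZero d}} → (1 // d) * ι d ≡ 1ℚ
1//-inverse (suc d) =
  trans (sym (fromℚᵘ-* p q)) (fromℚᵘ-cong {p ℚᵘ.* q} {ℚᵘ.mkℚᵘ (ℤ.+ 1) 0} (ℚᵘ.*≡* numerators))
  where
  p = ℚᵘ.mkℚᵘ (ℤ.+ 1) d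
  q = ℚᵘ.mkℚᵘ (ℤ.+ suc d) 0
  numerators : (ℤ.+ 1 ℤ.* ℤ.+ suc d) ℤ.* ℤ.+ 1 ≡ ℤ.+ 1 ℤ.* ℤ.+ (suc d ℕ.* 1)
  numerators = trans (ℤP.*-identityʳ (ℤ.+ 1 ℤ.* ℤ.+ suc d))
                     (cong (λ e → ℤ.+ 1 ℤ.* ℤ.+ e) (sym (ℕP.*-identityʳ (suc d))))

-- 1 / dⁿ = (1 / d)ⁿ: the denominators b^(…) of the theorem become powers of 1/b.
1//-^ : ∀ d .{{d≢0 : NonZero d}} n → _//_ 1 (d ℕ.^ n) {{m^n≢0 d n}} ≡ (1 // d) ^ n
1//-^ d         zero    = refl
1//-^ d {{d≢0}} (suc n) =
  trans (1//-* d (d ℕ.^ n) {{d≢0}} {{m^n≢0 d n}}) (cong ((1 // d) *_) (1//-^ d n))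

^-inverse : ∀ d .{{_ : NonZero d}} n → ι (d ℕ.^ n) * (1 // d) ^ n ≡ 1ℚ
^-inverse d n = begin
  ι dⁿ * (1 // d) ^ n   ≡⟨ cong (ι dⁿ *_) (sym (1//-^ d n)) ⟩
  ι dⁿ * 1/dⁿ           ≡⟨ *-comm (ι dⁿ) 1/dⁿ ⟩
  1/dⁿ * ι dⁿ           ≡⟨ 1//-inverse dⁿ {{m^n≢0 d n}} ⟩
  1ℚ                    ∎
  where
  dⁿ = d ℕ.^ n
  1/dⁿ = _//_ 1 dⁿ {{m^n≢0 d n}}

sumBelow-split : ∀ A B f → sumBelow (A ℕ.+ B) f ≡ sumBelow A f + sumBelow B (λ n → f (A ℕ.+ n))
sumBelow-split A zero f rewrite ℕP.+-identityʳ A =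
  solve 1 (λ x → x := x :+ con 0ℚ) refl (sumBelow A f)
sumBelow-split A (suc B) f rewrite ℕP.+-suc A B | sumBelow-split A B f =
  solve 3 (λ x y z → (x :+ y) :+ z := x :+ (y :+ z)) refl
    (sumBelow A f) (sumBelow B (λ n → f (A ℕ.+ n))) (f (A ℕ.+ B))

sumBelow-cong : ∀ N f g → (∀ n → n < N → f n ≡ g n) → sumBelow N f ≡ sumBelow N g
sumBelow-cong zero    f g f≗g = refl
sumBelow-cong (suc N) f g f≗g =
  cong₂ _+_ (sumBelow-cong N f g (λ n n<N → f≗g n (ℕP.m<n⇒m<1+n n<N))) (f≗g N ℕP.≤-refl)

sumBelow-minus-const : ∀ N f c → sumBelow N (λ n → f n - c) ≡ sumBelow N f - ι N * c
sumBelow-minus-const zero    f c = solve 1 (λ c → con 0ℚ := con 0ℚ :- con 0ℚ :* c) refl c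
sumBelow-minus-const (suc N) f c rewrite sumBelow-minus-const N f c | ι-+ 1 N =
  solve 4 (λ s n c x → (s :- n :* c) :+ (x :- c) := (s :+ x) :- (con 1ℚ :+ n) :* c) refl
    (sumBelow N f) (ι N) c (f N)

module Radix (b : ℕ) .{{_ : NonZero b}} where

  -- R = 1/b, the weight of the first digit after the radix point.
  b⁻¹ : ℚ
  b⁻¹ = 1 // b

  b⁻¹-inverse : b⁻¹ * ι b ≡ 1ℚ
  b⁻¹-inverse = 1//-inverse b

  Digits : (ℕ → ℕ) → ℕ → Set
  Digits a m = ∀ i → 1 ≤ i → i ≤ m → a i < b

  Digits-init : ∀ {a m} → Digits a (suc m) → Digits a m
  Digits-init digits i 1≤i i≤m = digits i 1≤i (ℕP.m≤n⇒m≤1+n i≤m)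

  Digits-last : ∀ {a m} → Digits a (suc m) → a (suc m) < b
  Digits-last digits = digits _ (s≤s z≤n) ℕP.≤-refl

  -- A number with m digits is below bᵐ:  N + a·bᵐ < (a + 1)·bᵐ ≤ b·bᵐ.
  digitValue< : ∀ a m → Digits a m → digitValue b m a < b ℕ.^ m
  digitValue< a zero    digits = s≤s z≤n
  digitValue< a (suc m) digits =
    ℕP.<-≤-trans (ℕP.+-monoˡ-< (a (suc m) ℕ.* b ℕ.^ m) (digitValue< a m (Digits-init digits)))
                 (ℕP.*-monoˡ-≤ (b ℕ.^ m) (Digits-last digits))

  -- Contribution c/2 - c(c-1)/(2b) of a leading digit c to the partial sums.
  digitTerm : ℕ → ℚ
  digitTerm c = ι c * ½ - b⁻¹ * (½ * (ι c * ι c - ι c))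

  digitTerm-zero : digitTerm 0 ≡ 0ℚ
  digitTerm-zero =
    solve 1 (λ r → con 0ℚ :* con ½ :- r :* (con ½ :* (con 0ℚ :* con 0ℚ :- con 0ℚ)) := con 0ℚ) refl b⁻¹

  digitTerm-suc : ∀ c → digitTerm (suc c) ≡ digitTerm c + ½ - ι c * b⁻¹
  digitTerm-suc c rewrite ι-+ 1 c =
    solve 2 (λ x r → (con 1ℚ :+ x) :* con ½ :- r :* (con ½ :* ((con 1ℚ :+ x) :* (con 1ℚ :+ x) :- (con 1ℚ :+ x)))
                  := (x :* con ½ :- r :* (con ½ :* (x :* x :- x))) :+ con ½ :- x :* r) refl (ι c) b⁻¹

  -- A full block of b digits contributes ½, which makes S(bᵐ⁺¹) = S(bᵐ) = ½.
  digitTerm-radix : digitTerm b ≡ ½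
  digitTerm-radix = begin
    ι b * ½ - b⁻¹ * (½ * (ι b * ι b - ι b))
      ≡⟨ solve 2 (λ x r → x :* con ½ :- r :* (con ½ :* (x :* x :- x))
                        := con ½ :+ (con ½ :* x :- con ½) :* (con 1ℚ :- r :* x)) refl (ι b) b⁻¹ ⟩
    ½ + (½ * ι b - ½) * (1ℚ - b⁻¹ * ι b)
      ≡⟨ cong (λ u → ½ + (½ * ι b - ½) * (1ℚ - u)) b⁻¹-inverse ⟩
    ½ + (½ * ι b - ½) * (1ℚ - 1ℚ)
      ≡⟨ solve 1 (λ x → con ½ :+ (con ½ :* x :- con ½) :* (con 1ℚ :- con 1ℚ) := con ½) refl (ι b) ⟩
    ½ ∎

  digitTerm-formula : ∀ c → c ≤ b ℕ.+ 1 →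
    _//_ ((b ℕ.+ 1) ℕ.* c ∸ c ℕ.* c) (2 ℕ.* b) {{m*n≢0 2 b}} ≡ digitTerm c
  digitTerm-formula c c≤b+1 = begin
    _//_ ((b ℕ.+ 1) ℕ.* c ∸ c ℕ.* c) (2 ℕ.* b) {{m*n≢0 2 b}}
      ≡⟨ //-as-product ((b ℕ.+ 1) ℕ.* c ∸ c ℕ.* c) (2 ℕ.* b) {{m*n≢0 2 b}} ⟩
    ι ((b ℕ.+ 1) ℕ.* c ∸ c ℕ.* c) * _//_ 1 (2 ℕ.* b) {{m*n≢0 2 b}}
      ≡⟨ cong₂ _*_ (ι-∸ ((b ℕ.+ 1) ℕ.* c) (c ℕ.* c) (ℕP.*-monoˡ-≤ c c≤b+1)) (1//-* 2 b) ⟩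
    (ι ((b ℕ.+ 1) ℕ.* c) - ι (c ℕ.* c)) * (½ * b⁻¹)
      ≡⟨ cong₂ (λ u v → (u - v) * (½ * b⁻¹)) (trans (ι-* (b ℕ.+ 1) c) (cong (_* ι c) (ι-+ b 1))) (ι-* c c) ⟩
    ((ι b + 1ℚ) * ι c - ι c * ι c) * (½ * b⁻¹)
      ≡⟨ solve 3 (λ y x r → ((y :+ con 1ℚ) :* x :- x :* x) :* (con ½ :* r)
                          := x :* con ½ :* (r :* y) :- r :* (con ½ :* (x :* x :- x))) refl (ι b) (ι c) b⁻¹ ⟩
    ι c * ½ * (b⁻¹ * ι b) - b⁻¹ * (½ * (ι c * ι c - ι c))
      ≡⟨ cong (λ u → ι c * ½ * u - b⁻¹ * (½ * (ι c * ι c - ι c))) b⁻¹-inverse ⟩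
    ι c * ½ * 1ℚ - b⁻¹ * (½ * (ι c * ι c - ι c))
      ≡⟨ cong (_- b⁻¹ * (½ * (ι c * ι c - ι c))) (*-identityʳ (ι c * ½)) ⟩
    digitTerm c ∎

  block-weight : ∀ c m → ι (b ℕ.^ m) * (ι c * b⁻¹ ^ suc m) ≡ ι c * b⁻¹
  block-weight c m = begin
    ι (b ℕ.^ m) * (ι c * (b⁻¹ * b⁻¹ ^ m))
      ≡⟨ solve 4 (λ p x r q → p :* (x :* (r :* q)) := x :* r :* (p :* q)) refl (ι (b ℕ.^ m)) (ι c) b⁻¹ (b⁻¹ ^ m) ⟩
    ι c * b⁻¹ * (ι (b ℕ.^ m) * b⁻¹ ^ m)  ≡⟨ cong (ι c * b⁻¹ *_) (^-inverse b m) ⟩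
    ι c * b⁻¹ * 1ℚ                       ≡⟨ *-identityʳ (ι c * b⁻¹) ⟩
    ι c * b⁻¹                            ∎

  rescale : ∀ x m k → m ≤ k → ι x * b⁻¹ ^ (k ∸ m) ≡ ι x * ι (b ℕ.^ m) * b⁻¹ ^ k
  rescale x m k m≤k = begin
    ι x * b⁻¹ ^ (k ∸ m)
      ≡⟨ cong (ι x *_) (sym (*-identityʳ (b⁻¹ ^ (k ∸ m)))) ⟩
    ι x * (b⁻¹ ^ (k ∸ m) * 1ℚ)
      ≡⟨ cong (λ u → ι x * (b⁻¹ ^ (k ∸ m) * u)) (sym (^-inverse b m)) ⟩
    ι x * (b⁻¹ ^ (k ∸ m) * (ι (b ℕ.^ m) * b⁻¹ ^ m))
      ≡⟨ solve 4 (λ u w p q → u :* (w :* (p :* q)) := u :* p :* (q :* w)) refl (ι x) (b⁻¹ ^ (k ∸ m)) (ι (b ℕ.^ m)) (b⁻¹ ^ m) ⟩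
    ι x * ι (b ℕ.^ m) * (b⁻¹ ^ m * b⁻¹ ^ (k ∸ m))
      ≡⟨ cong (ι x * ι (b ℕ.^ m) *_) (sym (^-homo-* b⁻¹ m (k ∸ m))) ⟩
    ι x * ι (b ℕ.^ m) * b⁻¹ ^ (m ℕ.+ (k ∸ m))
      ≡⟨ cong (λ n → ι x * ι (b ℕ.^ m) * b⁻¹ ^ n) (ℕP.m+[n∸m]≡n m≤k) ⟩
    ι x * ι (b ℕ.^ m) * b⁻¹ ^ k ∎

  column-sum : ∀ a c k m → m ≤ k →
    sumFrom1 m (λ i → _//_ (a i ℕ.* c) (b ℕ.^ (k ∸ i ℕ.+ 1)) {{m^n≢0 b (k ∸ i ℕ.+ 1)}})
      ≡ ι (digitValue b m a) * ι c * b⁻¹ ^ k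
  column-sum a c k zero    _   = solve 2 (λ x q → con 0ℚ := con 0ℚ :* x :* q) refl (ι c) (b⁻¹ ^ k)
  column-sum a c k (suc m) m<k = begin
    sumFrom1 m term + term (suc m)
      ≡⟨ cong₂ _+_ (column-sum a c k m (ℕP.<⇒≤ m<k)) last-term ⟩
    ι N * ι c * b⁻¹ ^ k + ι (d ℕ.* c) * ι P * b⁻¹ ^ k
      ≡⟨ cong (λ u → ι N * ι c * b⁻¹ ^ k + u * ι P * b⁻¹ ^ k) (ι-* d c) ⟩
    ι N * ι c * b⁻¹ ^ k + ι d * ι c * ι P * b⁻¹ ^ k
      ≡⟨ solve 5 (λ n x y p q → n :* x :* q :+ y :* x :* p :* q := (n :+ y :* p) :* x :* q) refl
                 (ι N) (ι c) (ι d) (ι P) (b⁻¹ ^ k) ⟩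
    (ι N + ι d * ι P) * ι c * b⁻¹ ^ k
      ≡⟨ cong (λ u → u * ι c * b⁻¹ ^ k) (sym (trans (ι-+ N (d ℕ.* P)) (cong (λ u → ι N + u) (ι-* d P)))) ⟩
    ι (digitValue b (suc m) a) * ι c * b⁻¹ ^ k ∎
    where
    N = digitValue b m a
    d = a (suc m)
    P = b ℕ.^ m
    term : ℕ → ℚ
    term i = _//_ (a i ℕ.* c) (b ℕ.^ (k ∸ i ℕ.+ 1)) {{m^n≢0 b (k ∸ i ℕ.+ 1)}}
    exponent : k ∸ suc m ℕ.+ 1 ≡ k ∸ m
    exponent = trans (sym (ℕP.+-∸-comm 1 m<k)) (cong (_∸ suc m) (ℕP.+-comm k 1))
    last-term : term (suc m) ≡ ι (d ℕ.* c) * ι P * b⁻¹ ^ k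
    last-term = begin
      term (suc m)
        ≡⟨ //-as-product (d ℕ.* c) (b ℕ.^ (k ∸ suc m ℕ.+ 1)) {{m^n≢0 b (k ∸ suc m ℕ.+ 1)}} ⟩
      ι (d ℕ.* c) * _//_ 1 (b ℕ.^ (k ∸ suc m ℕ.+ 1)) {{m^n≢0 b (k ∸ suc m ℕ.+ 1)}}
        ≡⟨ cong (ι (d ℕ.* c) *_) (trans (1//-^ b (k ∸ suc m ℕ.+ 1)) (cong (b⁻¹ ^_) exponent)) ⟩
      ι (d ℕ.* c) * b⁻¹ ^ (k ∸ m)
        ≡⟨ rescale (d ℕ.* c) m k (ℕP.<⇒≤ m<k) ⟩
      ι (d ℕ.* c) * ι P * b⁻¹ ^ k ∎

  diagonalSum : (ℕ → ℕ) → ℕ → ℚ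
  diagonalSum a m = sumFrom1 m (λ i → _//_ ((b ℕ.+ 1) ℕ.* a i ∸ a i ℕ.* a i) (2 ℕ.* b) {{m*n≢0 2 b}})

  crossSum : (ℕ → ℕ) → ℕ → ℚ
  crossSum a m = sumFrom1 m (λ j → sumFrom1 (j ∸ 1) (λ i →
                   _//_ (a i ℕ.* a j) (b ℕ.^ (j ∸ i ℕ.+ 1)) {{m^n≢0 b (j ∸ i ℕ.+ 1)}}))

module VanDerCorput (b : ℕ) .{{_ : NonZero b}} (b≥2 : 2 ≤ b) where
  open Radix b

  quotient≤ : ∀ n → suc n / b ≤ n
  quotient≤ n = ℕP.≤-pred (m/n<m (suc n) b b≥2)

  -- Any fuel k ≥ n computes the same radical inverse, as n / b < n for n > 0.
  vdcAux-fuel : ∀ k k' n → n ≤ k → n ≤ k' → vdcAux b k n ≡ vdcAux b k' n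
  vdcAux-fuel zero    zero     zero    _         _          = refl
  vdcAux-fuel zero    (suc k') zero    _         _          = refl
  vdcAux-fuel (suc k) zero     zero    _         _          = refl
  vdcAux-fuel (suc k) (suc k') zero    _         _          = refl
  vdcAux-fuel (suc k) (suc k') (suc n) (s≤s n≤k) (s≤s n≤k') =
    cong (λ x → ((suc n % b) // 1 + x) * b⁻¹)
         (vdcAux-fuel k k' (suc n / b) (ℕP.≤-trans (quotient≤ n) n≤k) (ℕP.≤-trans (quotient≤ n) n≤k'))

  -- The defining recursion  x n = (n mod b + x (n div b)) / b,  also at n = 0.
  vdc-unfold : ∀ n → vdc b n ≡ (ι (n % b) + vdc b (n / b)) * b⁻¹
  vdc-unfold zero = sym (begin
    (ι (0 % b) + vdc b (0 / b)) * b⁻¹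
      ≡⟨ cong₂ (λ r q → (ι r + vdc b q) * b⁻¹) (m<n⇒m%n≡m (ℕP.≤-trans (s≤s z≤n) b≥2)) (0/n≡0 b) ⟩
    (ι 0 + vdc b 0) * b⁻¹ ≡⟨ *-zeroˡ b⁻¹ ⟩
    0ℚ ∎)
  vdc-unfold (suc n) =
    cong (λ x → (ι (suc n % b) + x) * b⁻¹) (vdcAux-fuel n (suc n / b) (suc n / b) (quotient≤ n) ℕP.≤-refl)

  vdc-digit : ∀ r q → r < b → vdc b (r ℕ.+ q ℕ.* b) ≡ (ι r + vdc b q) * b⁻¹
  vdc-digit r q r<b = trans (vdc-unfold (r ℕ.+ q ℕ.* b)) (cong₂ (λ s t → (ι s + vdc b t) * b⁻¹) remainder quotient)
    where
    remainder : (r ℕ.+ q ℕ.* b) % b ≡ r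
    remainder = trans ([m+kn]%n≡m%n r q b) (m<n⇒m%n≡m r<b)
    quotient : (r ℕ.+ q ℕ.* b) / b ≡ q
    quotient = trans (+-distrib-/-∣ʳ r (n∣m*n q)) (cong₂ ℕ._+_ (m<n⇒m/n≡0 r<b) (m*n/n≡m q b))

  vdc-block : ∀ m c r → c < b → r < b ℕ.^ m → vdc b (c ℕ.* b ℕ.^ m ℕ.+ r) ≡ vdc b r + ι c * b⁻¹ ^ suc m
  vdc-block zero c zero c<b _ = begin
    vdc b (c ℕ.* 1 ℕ.+ 0)  ≡⟨ cong (vdc b) (trans (ℕP.+-identityʳ (c ℕ.* 1)) (ℕP.*-identityʳ c)) ⟩
    vdc b c                ≡⟨ cong (vdc b) (sym (ℕP.+-identityʳ c)) ⟩
    vdc b (c ℕ.+ 0 ℕ.* b)  ≡⟨ vdc-digit c 0 c<b ⟩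
    (ι c + 0ℚ) * b⁻¹       ≡⟨ solve 2 (λ x r → (x :+ con 0ℚ) :* r := con 0ℚ :+ x :* (r :* con 1ℚ)) refl (ι c) b⁻¹ ⟩
    0ℚ + ι c * (b⁻¹ * 1ℚ)  ∎
  vdc-block zero c (suc r) c<b (s≤s ())
  vdc-block (suc m) c r c<b r<bᵐ⁺¹ = begin
    vdc b (c ℕ.* b ℕ.^ suc m ℕ.+ r)               ≡⟨ cong (vdc b) regroup ⟩
    vdc b (r₀ ℕ.+ (c ℕ.* b ℕ.^ m ℕ.+ q) ℕ.* b)     ≡⟨ vdc-digit r₀ (c ℕ.* b ℕ.^ m ℕ.+ q) r₀<b ⟩
    (ι r₀ + vdc b (c ℕ.* b ℕ.^ m ℕ.+ q)) * b⁻¹     ≡⟨ cong (λ x → (ι r₀ + x) * b⁻¹) (vdc-block m c q c<b q<bᵐ) ⟩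
    (ι r₀ + (vdc b q + ι c * b⁻¹ ^ suc m)) * b⁻¹
      ≡⟨ solve 5 (λ x y z w r → (x :+ (y :+ z :* w)) :* r := (x :+ y) :* r :+ z :* (r :* w)) refl
                 (ι r₀) (vdc b q) (ι c) (b⁻¹ ^ suc m) b⁻¹ ⟩
    (ι r₀ + vdc b q) * b⁻¹ + ι c * b⁻¹ ^ suc (suc m)
      ≡⟨ cong (_+ ι c * b⁻¹ ^ suc (suc m)) (sym (trans (cong (vdc b) r-expansion) (vdc-digit r₀ q r₀<b))) ⟩
    vdc b r + ι c * b⁻¹ ^ suc (suc m) ∎
    where
    r₀ = r % b
    q = r / b
    r₀<b : r₀ < b
    r₀<b = m%n<n r b
    r-expansion : r ≡ r₀ ℕ.+ q ℕ.* b
    r-expansion = m≡m%n+[m/n]*n r b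
    q<bᵐ : q < b ℕ.^ m
    q<bᵐ = m<n*o⇒m/o<n (subst (r <_) (ℕP.*-comm b (b ℕ.^ m)) r<bᵐ⁺¹)
    shift : ∀ c P d r q → c ℕ.* (d ℕ.* P) ℕ.+ (r ℕ.+ q ℕ.* d) ≡ r ℕ.+ (c ℕ.* P ℕ.+ q) ℕ.* d
    shift = solve-∀
    regroup : c ℕ.* b ℕ.^ suc m ℕ.+ r ≡ r₀ ℕ.+ (c ℕ.* b ℕ.^ m ℕ.+ q) ℕ.* b
    regroup = trans (cong (c ℕ.* b ℕ.^ suc m ℕ.+_) r-expansion) (shift c (b ℕ.^ m) b r₀ q)

  S-shift : ∀ m c r → c < b → r ≤ b ℕ.^ m →
            S b (c ℕ.* b ℕ.^ m ℕ.+ r) ≡ S b (c ℕ.* b ℕ.^ m) + S b r - ι r * (ι c * b⁻¹ ^ suc m)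
  S-shift m c r c<b r≤bᵐ = begin
    S b (P ℕ.+ r)                                    ≡⟨ sumBelow-split P r (λ n → ½ - vdc b n) ⟩
    S b P + sumBelow r (λ n → ½ - vdc b (P ℕ.+ n))   ≡⟨ cong (S b P +_) (sumBelow-cong r _ _ shifted) ⟩
    S b P + sumBelow r (λ n → (½ - vdc b n) - δ)     ≡⟨ cong (S b P +_) (sumBelow-minus-const r (λ n → ½ - vdc b n) δ) ⟩
    S b P + (S b r - ι r * δ)                        ≡⟨ solve 3 (λ x y z → x :+ (y :- z) := x :+ y :- z) refl (S b P) (S b r) (ι r * δ) ⟩
    S b P + S b r - ι r * δ                          ∎
    where
    P = c ℕ.* b ℕ.^ m
    δ = ι c * b⁻¹ ^ suc m
    shifted : ∀ n → n < r → ½ - vdc b (P ℕ.+ n) ≡ (½ - vdc b n) - δ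
    shifted n n<r = trans (cong (½ -_) (vdc-block m c n c<b (ℕP.<-≤-trans n<r r≤bᵐ)))
                          (solve 3 (λ h x d → h :- (x :+ d) := (h :- x) :- d) refl ½ (vdc b n) δ)

  S-block : ∀ m c → c ≤ b → S b (c ℕ.* b ℕ.^ m) ≡ digitTerm c
  S-pow : ∀ m → S b (b ℕ.^ m) ≡ ½

  S-block m zero    _   = sym digitTerm-zero
  S-block m (suc c) c<b = begin
    S b (b ℕ.^ m ℕ.+ c ℕ.* b ℕ.^ m)  ≡⟨ cong (S b) (ℕP.+-comm (b ℕ.^ m) (c ℕ.* b ℕ.^ m)) ⟩
    S b (c ℕ.* b ℕ.^ m ℕ.+ b ℕ.^ m)  ≡⟨ S-shift m c (b ℕ.^ m) c<b ℕP.≤-refl ⟩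
    S b (c ℕ.* b ℕ.^ m) + S b (b ℕ.^ m) - ι (b ℕ.^ m) * (ι c * b⁻¹ ^ suc m)
      ≡⟨ cong₂ (λ u v → u + v - ι (b ℕ.^ m) * (ι c * b⁻¹ ^ suc m)) (S-block m c (ℕP.<⇒≤ c<b)) (S-pow m) ⟩
    digitTerm c + ½ - ι (b ℕ.^ m) * (ι c * b⁻¹ ^ suc m)
      ≡⟨ cong (digitTerm c + ½ -_) (block-weight c m) ⟩
    digitTerm c + ½ - ι c * b⁻¹      ≡⟨ sym (digitTerm-suc c) ⟩
    digitTerm (suc c)                ∎

  S-pow zero    = refl
  S-pow (suc m) = trans (S-block m b ℕP.≤-refl) digitTerm-radix

proposition6 : (b : ℕ) .{{_ : NonZero b}} → 2 ≤ b → (m : ℕ) → (a : ℕ → ℕ)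
    → (∀ i → 1 ≤ i → i ≤ m → a i < b)
    → S b (digitValue b m a)
      ≡ sumFrom1 m (λ i → _//_ ((b ℕ.+ 1) ℕ.* a i ∸ a i ℕ.* a i) (2 ℕ.* b) {{m*n≢0 2 b}})
        - sumFrom1 m (λ j → sumFrom1 (j ∸ 1) (λ i →
            _//_ (a i ℕ.* a j) (b ℕ.^ (j ∸ i ℕ.+ 1)) {{m^n≢0 b (j ∸ i ℕ.+ 1)}}))
proposition6 b b≥2 zero    a digits = refl
proposition6 b b≥2 (suc m) a digits = begin
  S b (N ℕ.+ d ℕ.* b ℕ.^ m)                                  ≡⟨ cong (S b) (ℕP.+-comm N (d ℕ.* b ℕ.^ m)) ⟩
  S b (d ℕ.* b ℕ.^ m ℕ.+ N)                                  ≡⟨ S-shift m d N d<b (ℕP.<⇒≤ (digitValue< a m (Digits-init digits))) ⟩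
  S b (d ℕ.* b ℕ.^ m) + S b N - ι N * (ι d * b⁻¹ ^ suc m)
    ≡⟨ cong₂ (λ u v → u + v - ι N * (ι d * b⁻¹ ^ suc m)) (S-block m d (ℕP.<⇒≤ d<b))
             (proposition6 b b≥2 m a (Digits-init digits)) ⟩
  digitTerm d + (diagonalSum a m - crossSum a m) - ι N * (ι d * b⁻¹ ^ suc m)
    ≡⟨ solve 6 (λ t x y n e q → t :+ (x :- y) :- n :* (e :* q) := (x :+ t) :- (y :+ n :* e :* q)) refl
               (digitTerm d) (diagonalSum a m) (crossSum a m) (ι N) (ι d) (b⁻¹ ^ suc m) ⟩
  (diagonalSum a m + digitTerm d) - (crossSum a m + ι N * ι d * b⁻¹ ^ suc m)
    ≡⟨ cong₂ (λ u v → (diagonalSum a m + u) - (crossSum a m + v))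
             (sym (digitTerm-formula d (ℕP.m≤n⇒m≤n+o 1 (ℕP.<⇒≤ d<b))))
             (sym (column-sum a d (suc m) m (ℕP.n≤1+n m))) ⟩
  diagonalSum a (suc m) - crossSum a (suc m) ∎
  where
  open Radix b
  open VanDerCorput b b≥2
  N = digitValue b m a
  d = a (suc m)
  d<b : d < b
  d<b = Digits-last digits
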